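{- Let $\mathcal H\subseteq 2^V$ be a unimodular Sperner hypergraph, $V=V_1\dot\cup V_2$ with $V_1,V_2\ne\emptyset$, and $S_1\subseteq V_1$, $S_2\subseteq V_2$ nonempty, such that: every $H\in\mathcal H$ with $H\cap V_1\neq\emptyset\neq H\cap V_2$ satisfies $H\cap V_1=S_1$ or $H\cap V_2=S_2$; $\mathcal H(V_1,S_1)\neq\emptyset$, $\mathcal H(V_1,S_1)^{V_2}\neq\{\emptyset\}$, $\mathcal H(V_2,S_2)\neq\emptyset$, $\mathcal H(V_2,S_2)^{V_1}\neq\{\emptyset\}$; $|V_1|+|\mathcal H_{V_1}\cup\mathcal H(V_2,S_2)|\ge 4$ and $|V_2|+|\mathcal H_{V_2}\cup\mathcal H(V_1,S_1)|\ge4$; and there is $H_0\in\mathcal H$ with $H_0\subseteq S_1\cup S_2$, $H_0\cap V_1=S_1$ and $H_0\cap V_2\subseteq S_2$. Let $v_1,v_2$ be new vertices and define $\bar\mathcal H_1=\mathcal H_{V_1}\cup\{(H\setminus S_2)\cup\{v_2\}\mid H\in\mathcal H(V_2,S_2)\}\cup\{(H_0\setminus S_2)\cup\{v_2\}\}$ and $\bar\mathcal H_2=\mathcal H_{V_2}\cup\{(H\setminus S_1)\cup\{v_1\}\mid H\in\mathcal H(V_1,S_1)\}$. Then $|\operatorname{Tr}(\bar\mathcal H_1)|\le|\operatorname{Tr}(\mathcal H)|$ and $|\operatorname{Tr}(\bar\mathcal H_2)|\le|\operatorname{Tr}(\mathcal H)|$.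
   Context: For a hypergraph $\mathcal H$, $\operatorname{Tr}(\mathcal H)$ is the family of inclusion-minimal transversals (sets meeting every hyperedge). A hypergraph is Sperner if no hyperedge contains another; unimodular if its hyperedge–vertex incidence $0/1$ matrix is totally unimodular. Notation: $\mathcal H_S=\{H\in\mathcal H\mid H\subseteq S\}$; $\mathcal H^S=\operatorname{Min}\{H\cap S\mid H\in\mathcal H\}$ ($\operatorname{Min}$ = inclusion-minimal members); $\mathcal H(W,S)=\{H\in\mathcal H\mid H\cap W=S\}$. -}

module Defs where

open import Data.Nat as ℕ using (ℕ; zero; suc)
open import Data.Integer as ℤ using (ℤ; +_; -[1+_])
open import Data.Bool using (Bool; true; false; if_then_else_)
import Data.Bool.Properties as BoolP
open import Data.Fin using (Fin; zero; suc; toℕ; punchIn)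
open import Data.Fin.Subset using (Subset; inside; outside; _⊆_; _∩_; _∪_; _─_; Nonempty; ⁅_⁆)
  renaming (⊥ to ∅)
open import Data.Fin.Subset.Properties using (nonempty?; _⊆?_; anySubset?)
open import Data.Vec using (Vec; []; _∷_; lookup)
import Data.Vec.Properties as VecP
open import Data.List using (List; []; _∷_; _++_; map; filter; length; [_])
import Data.List.Membership.DecPropositional as DecMem
open import Data.List.Membership.Propositional using () renaming (_∈_ to _∈ₗ_)
import Data.List.Relation.Unary.All as All
open import Data.Product using (Σ; ∃; _×_; _,_; proj₁; proj₂)
open import Data.Sum using (_⊎_)
open import Relation.Nullary using (Dec; yes; no; ¬_; _×-dec_; _⊎-dec_; ¬?)
open import Relation.Unary using (Pred; Decidable)
open import Relation.Binary.PropositionalEquality using (_≡_; _≢_)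
open import Relation.Binary.Definitions using (DecidableEquality)
open import Function using (Injective; _⇔_)
open import Level using (0ℓ)

_≟ₛ_ : ∀ {n} → DecidableEquality (Subset n)
_≟ₛ_ = VecP.≡-dec BoolP._≟_

_∈ₗ?_ : ∀ {n} (E : Subset n) (ℋ : List (Subset n)) → Dec (E ∈ₗ ℋ)
_∈ₗ?_ {n} = DecMem._∈?_ (_≟ₛ_ {n})

Hypergraph : ℕ → Set
Hypergraph n = List (Subset n)

-- all subsets of Fin n, each exactly once
allSubsets : ∀ n → List (Subset n)
allSubsets zero    = [ [] ]
allSubsets (suc n) = map (inside ∷_) (allSubsets n) ++ map (outside ∷_) (allSubsets n)

countSubsets : ∀ {n} {P : Pred (Subset n) 0ℓ} → Decidable P → ℕ
countSubsets {n} P? = length (filter P? (allSubsets n))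

-- Sperner: no hyperedge contains another (distinct list positions are
-- distinct hyperedges, so the list is in particular duplicate-free).

Sperner : ∀ {n} → Hypergraph n → Set
Sperner ℋ = ∀ i j → i ≢ j → ¬ (lookupL i ⊆ lookupL j)
  where lookupL = Data.List.lookup ℋ

-- Unimodularity: the hyperedge–vertex incidence matrix is totally
-- unimodular (every square submatrix has determinant in {-1,0,1}).

sumFin : ∀ {k} → (Fin k → ℤ) → ℤ
sumFin {zero}  f = + 0
sumFin {suc k} f = f zero ℤ.+ sumFin (λ i → f (suc i))

sign : ℕ → ℤ
sign zero          = + 1
sign (suc zero)    = -[1+ 0 ]
sign (suc (suc m)) = sign m

det : ∀ {k} → (Fin k → Fin k → ℤ) → ℤ
det {zero}  M = + 1
det {suc k} M = sumFin λ j → sign (toℕ j) ℤ.* (M zero j ℤ.* det (λ i l → M (suc i) (punchIn j l)))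

incidence : ∀ {n} (ℋ : Hypergraph n) → Fin (length ℋ) → Fin n → ℤ
incidence ℋ e v = if lookup (Data.List.lookup ℋ e) v then + 1 else + 0

Unimodular : ∀ {n} → Hypergraph n → Set
Unimodular {n} ℋ =
  ∀ k (r : Fin k → Fin (length ℋ)) (c : Fin k → Fin n) →
  Injective _≡_ _≡_ r → Injective _≡_ _≡_ c →
  let d = det (λ i j → incidence ℋ (r i) (c j))
  in d ≡ -[1+ 0 ] ⊎ d ≡ + 0 ⊎ d ≡ + 1

Transversal : ∀ {n} → Hypergraph n → Subset n → Set
Transversal ℋ T = ∀ E → E ∈ₗ ℋ → Nonempty (E ∩ T)

MinTransversal : ∀ {n} → Hypergraph n → Subset n → Set
MinTransversal ℋ T = Transversal ℋ T × (∀ T′ → T′ ⊆ T → Transversal ℋ T′ → T′ ≡ T)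

transversal? : ∀ {n} (ℋ : Hypergraph n) → Decidable (Transversal ℋ)
transversal? ℋ T with All.all? (λ E → nonempty? (E ∩ T)) ℋ
... | yes a = yes (λ E E∈ → All.lookup a E∈)
... | no ¬a = no (λ t → ¬a (All.tabulate (λ {E} E∈ → t E E∈)))

minTransversal? : ∀ {n} (ℋ : Hypergraph n) → Decidable (MinTransversal ℋ)
minTransversal? ℋ T with transversal? ℋ T
... | no ¬t = no (λ m → ¬t (proj₁ m))
... | yes t with anySubset? (λ T′ → (T′ ⊆? T) ×-dec (transversal? ℋ T′ ×-dec ¬? (T′ ≟ₛ T)))
...   | yes (T′ , s , t′ , ne) = no (λ m → ne (proj₂ m T′ s t′))
...   | no ¬ex = yes (t , λ T′ s t′ → dne T′ s t′ (λ ne → ¬ex (T′ , s , t′ , ne)))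
  where
  dne : ∀ T′ → T′ ⊆ T → Transversal ℋ T′ → ¬ ¬ (T′ ≡ T) → T′ ≡ T
  dne T′ _ _ nn with T′ ≟ₛ T
  ... | yes e = e
  ... | no ne = Data.Empty.⊥-elim (nn ne)
    where import Data.Empty

∣Tr_∣ : ∀ {n} → Hypergraph n → ℕ
∣Tr ℋ ∣ = countSubsets (minTransversal? ℋ)

restrictTo : ∀ {n} → Hypergraph n → Subset n → Pred (Subset n) 0ℓ
restrictTo ℋ S E = E ∈ₗ ℋ × E ⊆ S

withTrace : ∀ {n} → Hypergraph n → Subset n → Subset n → Pred (Subset n) 0ℓ
withTrace ℋ W S E = E ∈ₗ ℋ × E ∩ W ≡ S

traceMin : ∀ {n} → Pred (Subset n) 0ℓ → Subset n → Pred (Subset n) 0ℓ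
traceMin ℱ S X = (∃ λ E → ℱ E × E ∩ S ≡ X) × (∀ E → ℱ E → E ∩ S ⊆ X → E ∩ S ≡ X)

IsEmptySetOnly : ∀ {n} → Pred (Subset n) 0ℓ → Set
IsEmptySetOnly 𝒢 = ∀ X → 𝒢 X ⇔ (X ≡ ∅)

restrict∪withTrace? : ∀ {n} (ℋ : Hypergraph n) (V₁ V₂ S₂ : Subset n) →
  Decidable (λ E → restrictTo ℋ V₁ E ⊎ withTrace ℋ V₂ S₂ E)
restrict∪withTrace? ℋ V₁ V₂ S₂ E =
  ((E ∈ₗ? ℋ) ×-dec (E ⊆? V₁)) ⊎-dec ((E ∈ₗ? ℋ) ×-dec ((E ∩ V₂) ≟ₛ S₂))

-- The two reduced hypergraphs on Fin (suc n): the new vertex is zero,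
-- an old vertex v is suc v.

lift : ∀ {n} → Subset n → Subset (suc n)
lift E = outside ∷ E

liftWithNew : ∀ {n} → Subset n → Subset (suc n)
liftWithNew E = inside ∷ E

reduced₁ : ∀ {n} → Hypergraph n → (V₁ V₂ S₂ H₀ : Subset n) → Hypergraph (suc n)
reduced₁ ℋ V₁ V₂ S₂ H₀ =
  map lift (filter (_⊆? V₁) ℋ)
  ++ map (λ H → liftWithNew (H ─ S₂)) (filter (λ H → (H ∩ V₂) ≟ₛ S₂) ℋ)
  ++ [ liftWithNew (H₀ ─ S₂) ]

reduced₂ : ∀ {n} → Hypergraph n → (V₁ V₂ S₁ : Subset n) → Hypergraph (suc n)
reduced₂ ℋ V₁ V₂ S₁ =
  map lift (filter (_⊆? V₂) ℋ)
  ++ map (λ H → liftWithNew (H ─ S₁)) (filter (λ H → (H ∩ V₁) ≟ₛ S₁) ℋ)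

-- Write W for the kept side and Z for the side contracted to the new vertex, with S ⊆ Z the
-- contracted trace.  A minimal transversal of the reduced hypergraph is a new-vertex bit b
-- together with T₀ ⊆ W.  The traces on Z of the hyperedges missed by T₀ are hit by Z, and even by
-- Z ∖ S when b is false: then T₀ meets every extension, so the crossing condition, the extension
-- coming from H₀ and the Sperner property force every missed hyperedge to meet Z ∖ S.  For a
-- minimal transversal K of these traces inside that set, T₀ ∪ K is a minimal transversal of ℋ
-- that M ↦ (M meets S) ∷ (M ∩ W) sends back, so Tr(ℋ) maps onto Tr of the reduced hypergraph.
module Submission where

open import Defs
open import Data.Bool using (Bool; true; false)
open import Data.Empty using (⊥; ⊥-elim)
open import Data.Fin using (Fin; zero; suc)
open import Data.Fin.Properties using (injective⇒≤; 0≢1+n; suc-injective) renaming (_≟_ to _≟ᶠ_)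
open import Data.Fin.Subset
  using (Subset; inside; outside; _∈_; _∉_; _⊆_; _⊈_; _⊂_; _∩_; _∪_; _─_; _-_; Nonempty; ∣_∣)
  renaming (⊥ to ∅; ⊤ to full)
open import Data.Fin.Subset.Properties
open import Data.List using (List; []; _∷_; _++_; map; filter; length; lookup)
open import Data.List.Membership.Propositional using (find) renaming (_∈_ to _∈ₗ_)
open import Data.List.Membership.Propositional.Properties
open import Data.List.Properties using (length-map)
open import Data.List.Relation.Binary.Subset.Propositional using () renaming (_⊆_ to _⊆ₗ_)
import Data.List.Relation.Unary.All as All
open import Data.List.Relation.Unary.All.Properties using (¬All⇒Any¬)
open import Data.List.Relation.Unary.Any using (here; there; index)
open import Data.List.Relation.Unary.Any.Properties using (lookup-index)
open import Data.List.Relation.Unary.Unique.Propositional using (Unique; []; _∷_)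
import Data.List.Relation.Unary.Unique.Propositional.Properties as Unique
open import Data.Nat using (ℕ; zero; suc; _+_; _≤_; _≥_)
open import Data.Nat.Induction using (<-wellFounded)
import Data.Nat.Properties as ℕ
open import Data.Product using (∃; _×_; _,_; proj₁; proj₂)
open import Data.Sum using (_⊎_; inj₁; inj₂; [_,_]; swap)
open import Data.Vec using ([]; _∷_; here; there)
open import Data.Vec.Properties using (∷-injectiveʳ)
open import Function using (_∘_)
open import Function.Bundles using (mk⇔)
open import Induction.WellFounded using (WellFounded; module Subrelation)
import Induction.WellFounded as WF
open import Level using (0ℓ)
open import Relation.Binary.Construct.On as On using ()
open import Relation.Binary.PropositionalEquality using (_≡_; _≢_; refl; sym; trans; cong; cong₂; subst)
open import Relation.Nullary using (¬_; yes; no; does; ¬?; _×-dec_)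
open import Relation.Nullary.Decidable using (dec-true; dec-false; decidable-stable)
open import Relation.Unary using (Pred; Decidable)

module _ {A : Set} where

  Unique⇒lookup-injective : ∀ {xs : List A} → Unique xs → ∀ i j → lookup xs i ≡ lookup xs j → i ≡ j
  Unique⇒lookup-injective (_ ∷ _) zero zero _ = refl
  Unique⇒lookup-injective (x∉ ∷ _) zero (suc j) eq = ⊥-elim (All.lookup x∉ (∈-lookup j) eq)
  Unique⇒lookup-injective (x∉ ∷ _) (suc i) zero eq = ⊥-elim (All.lookup x∉ (∈-lookup i) (sym eq))
  Unique⇒lookup-injective (_ ∷ u) (suc i) (suc j) eq = cong suc (Unique⇒lookup-injective u i j eq)

  Unique-⊆⇒length≤ : ∀ {xs ys : List A} → Unique xs → xs ⊆ₗ ys → length xs ≤ length ys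
  Unique-⊆⇒length≤ {xs} {ys} u xs⊆ys = injective⇒≤ position-injective
    where
    position : Fin (length xs) → Fin (length ys)
    position i = index (xs⊆ys (∈-lookup i))

    position-injective : ∀ {i j} → position i ≡ position j → i ≡ j
    position-injective {i} {j} eq = Unique⇒lookup-injective u i j (trans
      (lookup-index (xs⊆ys (∈-lookup i)))
      (trans (cong (lookup ys) eq) (sym (lookup-index (xs⊆ys (∈-lookup j))))))

∈-allSubsets : ∀ n (X : Subset n) → X ∈ₗ allSubsets n
∈-allSubsets zero [] = here refl
∈-allSubsets (suc n) (inside ∷ X) = ∈-++⁺ˡ (∈-map⁺ (inside ∷_) (∈-allSubsets n X))
∈-allSubsets (suc n) (outside ∷ X) =
  ∈-++⁺ʳ (map (inside ∷_) (allSubsets n)) (∈-map⁺ (outside ∷_) (∈-allSubsets n X))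

allSubsets-unique : ∀ n → Unique (allSubsets n)
allSubsets-unique zero = All.[] ∷ []
allSubsets-unique (suc n) =
  Unique.++⁺ (Unique.map⁺ ∷-injectiveʳ (allSubsets-unique n))
             (Unique.map⁺ ∷-injectiveʳ (allSubsets-unique n)) disjoint
  where

  disjoint : ∀ {X} → ¬ (X ∈ₗ map (inside ∷_) (allSubsets n) × X ∈ₗ map (outside ∷_) (allSubsets n))
  disjoint (X∈ , X∈′) with ∈-map⁻ (inside ∷_) X∈ | ∈-map⁻ (outside ∷_) X∈′
  ... | _ , _ , refl | _ , _ , ()

countSubsets-≤ : ∀ {m n} {P : Pred (Subset m) 0ℓ} {Q : Pred (Subset n) 0ℓ}
  (P? : Decidable P) (Q? : Decidable Q) (f : Subset n → Subset m) →
  (∀ X → P X → ∃ λ Y → Q Y × f Y ≡ X) → countSubsets P? ≤ countSubsets Q?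
countSubsets-≤ {m} {n} P? Q? f onto = begin
  length (filter P? (allSubsets m))
    ≤⟨ Unique-⊆⇒length≤ (Unique.filter⁺ P? (allSubsets-unique m)) covered ⟩
  length (map f (filter Q? (allSubsets n)))
    ≡⟨ length-map f (filter Q? (allSubsets n)) ⟩
  length (filter Q? (allSubsets n))
    ∎
  where
  open ℕ.≤-Reasoning
  covered : filter P? (allSubsets m) ⊆ₗ map f (filter Q? (allSubsets n))
  covered X∈ with onto _ (proj₂ (∈-filter⁻ P? {xs = allSubsets m} X∈))
  ... | Y , QY , refl = ∈-map⁺ f (∈-filter⁺ Q? (∈-allSubsets n Y) QY)

x∈p─q⇒x∉q : ∀ {n} {x : Fin n} (p q : Subset n) → x ∈ p ─ q → x ∉ q
x∈p─q⇒x∉q {x = zero} (inside ∷ p) (outside ∷ q) here = λ ()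
x∈p─q⇒x∉q {x = zero} (inside ∷ p) (inside ∷ q) ()
x∈p─q⇒x∉q {x = zero} (outside ∷ p) (outside ∷ q) ()
x∈p─q⇒x∉q {x = zero} (outside ∷ p) (inside ∷ q) ()
x∈p─q⇒x∉q {x = suc x} (_ ∷ p) (_ ∷ q) (there x∈p─q) = x∈p─q⇒x∉q p q x∈p─q ∘ drop-there

∩-Nonempty⁺ : ∀ {n} {x : Fin n} {p q : Subset n} → x ∈ p → x ∈ q → Nonempty (p ∩ q)
∩-Nonempty⁺ x∈p x∈q = _ , x∈p∩q⁺ (x∈p , x∈q)

∩-Nonempty⁻ : ∀ {n} (p q : Subset n) → Nonempty (p ∩ q) → ∃ λ x → x ∈ p × x ∈ q
∩-Nonempty⁻ p q (x , x∈p∩q) = x , x∈p∩q⁻ p q x∈p∩q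

⊈⇒Nonempty─ : ∀ {n} {p q : Subset n} → p ⊈ q → Nonempty (p ─ q)
⊈⇒Nonempty─ {p = p} {q} p⊈q = decidable-stable (nonempty? (p ─ q)) λ p─q-empty →
  p⊈q λ {x} x∈p → decidable-stable (x ∈? q) λ x∉q → p─q-empty (x , x∈p∧x∉q⇒x∈p─q x∈p x∉q)

⊆∪⇒─⊆ : ∀ {n} {p q r : Subset n} → p ⊆ q ∪ r → p ─ q ⊆ r
⊆∪⇒─⊆ {p = p} {q} {r} p⊆q∪r x∈p─q =
  [ (λ x∈q → ⊥-elim (x∈p─q⇒x∉q p q x∈p─q x∈q)) , (λ x∈r → x∈r) ]
  (x∈p∪q⁻ q r (p⊆q∪r (p─q⊆p p q x∈p─q)))

⊆∧≢⇒⊂ : ∀ {n} {p q : Subset n} → p ⊆ q → p ≢ q → p ⊂ q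
⊆∧≢⇒⊂ {p = []} {[]} _ p≢q = ⊥-elim (p≢q refl)
⊆∧≢⇒⊂ {p = outside ∷ p} {outside ∷ q} p⊆q p≢q = s⊂s (⊆∧≢⇒⊂ (drop-∷-⊆ p⊆q) (p≢q ∘ cong (outside ∷_)))
⊆∧≢⇒⊂ {p = inside ∷ p} {inside ∷ q} p⊆q p≢q = s⊂s (⊆∧≢⇒⊂ (drop-∷-⊆ p⊆q) (p≢q ∘ cong (inside ∷_)))
⊆∧≢⇒⊂ {p = outside ∷ p} {inside ∷ q} p⊆q _ = out⊂in (drop-∷-⊆ p⊆q)
⊆∧≢⇒⊂ {p = inside ∷ p} {outside ∷ q} p⊆q _ with p⊆q here
... | ()

⊂-wellFounded : ∀ {n} → WellFounded (_⊂_ {n})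
⊂-wellFounded = Subrelation.wellFounded p⊂q⇒∣p∣<∣q∣ (On.wellFounded ∣_∣ <-wellFounded)

Nonempty-lift∩⁻ : ∀ {n} {E T : Subset n} {b} → Nonempty (lift E ∩ (b ∷ T)) → Nonempty (E ∩ T)
Nonempty-lift∩⁻ (suc x , there x∈E∩T) = x , x∈E∩T

Nonempty-liftWithNew∩⁻ : ∀ {n} {E T : Subset n} →
  Nonempty (liftWithNew E ∩ (outside ∷ T)) → Nonempty (E ∩ T)
Nonempty-liftWithNew∩⁻ (suc x , there x∈E∩T) = x , x∈E∩T

MeetsOnlyAt : ∀ {m} → Subset m → Subset m → Fin m → Set
MeetsOnlyAt E T x = ∀ {y} → y ∈ E → y ∈ T → y ≡ x

module _ {m : ℕ} (ℱ : Hypergraph m) where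

  ¬Transversal⇒missed : ∀ {T} → ¬ Transversal ℱ T → ∃ λ E → E ∈ₗ ℱ × ¬ Nonempty (E ∩ T)
  ¬Transversal⇒missed {T} ¬tr =
    find (¬All⇒Any¬ (λ E → nonempty? (E ∩ T)) ℱ λ all → ¬tr λ E E∈ → All.lookup all E∈)

  minimal⇒privateEdge : ∀ {T} → MinTransversal ℱ T → ∀ {x} → x ∈ T →
    ∃ λ E → E ∈ₗ ℱ × x ∈ E × MeetsOnlyAt E T x
  minimal⇒privateEdge {T} (tr , minimal) {x} x∈T with ¬Transversal⇒missed T-x-not-transversal
    where
    T-x-not-transversal : ¬ Transversal ℱ (T - x)
    T-x-not-transversal tr′ = ⊂-irref (minimal (T - x) (p─q⊆p T _) tr′) (x∈p⇒p-x⊂p x∈T)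
  ... | E , E∈ , misses = E , E∈ , x∈E , only
    where
    only : MeetsOnlyAt E T x
    only {y} y∈E y∈T = decidable-stable (y ≟ᶠ x) λ y≢x → misses (∩-Nonempty⁺ y∈E (x∈p∧x≢y⇒x∈p-y y∈T y≢x))

    x∈E : x ∈ E
    x∈E with ∩-Nonempty⁻ E T (tr E E∈)
    ... | y , y∈E , y∈T = subst (_∈ E) (only y∈E y∈T) y∈E

  privateEdges⇒minimal : ∀ {T} → Transversal ℱ T →
    (∀ {x} → x ∈ T → ∃ λ E → E ∈ₗ ℱ × MeetsOnlyAt E T x) → MinTransversal ℱ T
  privateEdges⇒minimal {T} tr privateEdge = tr , λ T′ T′⊆T tr′ → ⊆-antisym T′⊆T (T⊆T′ T′⊆T tr′)
    where
    T⊆T′ : ∀ {T′} → T′ ⊆ T → Transversal ℱ T′ → T ⊆ T′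
    T⊆T′ {T′} T′⊆T tr′ x∈T with privateEdge x∈T
    ... | E , E∈ , only with ∩-Nonempty⁻ E T′ (tr′ E E∈)
    ...   | y , y∈E , y∈T′ = subst (_∈ T′) (only y∈E (T′⊆T y∈T′)) y∈T′

  minimal-⊆ : ∀ {T} → Transversal ℱ T → ∃ λ K → K ⊆ T × MinTransversal ℱ K
  minimal-⊆ {T} = WF.All.wfRec ⊂-wellFounded 0ℓ
    (λ T → Transversal ℱ T → ∃ λ K → K ⊆ T × MinTransversal ℱ K) step T
    where
    step : ∀ T → (∀ {T′} → T′ ⊂ T → Transversal ℱ T′ → ∃ λ K → K ⊆ T′ × MinTransversal ℱ K) →
      Transversal ℱ T → ∃ λ K → K ⊆ T × MinTransversal ℱ K
    step T rec tr with anySubset? (λ T′ → T′ ⊂? T ×-dec transversal? ℱ T′)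
    ... | yes (T′ , T′⊂T , tr′) with rec T′⊂T tr′
    ...   | K , K⊆T′ , minK = K , ⊆-trans K⊆T′ (proj₁ T′⊂T) , minK
    step T rec tr | no ∄smaller = T , ⊆-refl , tr , λ T′ T′⊆T tr′ →
      decidable-stable (T′ ≟ₛ T) λ T′≢T → ∄smaller (T′ , ⊆∧≢⇒⊂ T′⊆T T′≢T , tr′)

module _ {n : ℕ} {ℋ : Hypergraph n} where

  Sperner⇒⊆-edge≡ : Sperner ℋ → ∀ {E F} → E ∈ₗ ℋ → F ∈ₗ ℋ → E ⊆ F → E ≡ F
  Sperner⇒⊆-edge≡ sperner E∈ F∈ E⊆F with index E∈ ≟ᶠ index F∈
  ... | yes i≡j = trans (lookup-index E∈) (trans (cong (lookup ℋ) i≡j) (sym (lookup-index F∈)))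
  ... | no i≢j = ⊥-elim (sperner _ _ i≢j λ x∈ →
    subst (_ ∈_) (lookup-index F∈) (E⊆F (subst (_ ∈_) (sym (lookup-index E∈)) x∈)))

  edge⇒traceMin-isEmptySetOnly : ∀ {A B S} → S ∈ₗ ℋ → S ⊆ A → A ∩ B ≡ ∅ →
    IsEmptySetOnly (traceMin (withTrace ℋ A S) B)
  edge⇒traceMin-isEmptySetOnly {A} {B} {S} S∈ S⊆A A∩B≡∅ X = mk⇔ (only-∅ X) (∅-minimal X)
    where
    S∩B≡∅ : S ∩ B ≡ ∅
    S∩B≡∅ = Empty-unique λ (x , x∈S∩B) → let x∈S , x∈B = x∈p∩q⁻ S B x∈S∩B in
      ∉⊥ (subst (x ∈_) A∩B≡∅ (x∈p∩q⁺ (S⊆A x∈S , x∈B)))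

    S∩A≡S : S ∩ A ≡ S
    S∩A≡S = ⊆-antisym (p∩q⊆p S A) λ x∈S → x∈p∩q⁺ (x∈S , S⊆A x∈S)

    only-∅ : ∀ X → traceMin (withTrace ℋ A S) B X → X ≡ ∅
    only-∅ X (_ , minimal) =
      trans (sym (minimal S (S∈ , S∩A≡S) (λ x∈ → ⊥-elim (∉⊥ (subst (_ ∈_) S∩B≡∅ x∈))))) S∩B≡∅

    ∅-minimal : ∀ X → X ≡ ∅ → traceMin (withTrace ℋ A S) B X
    ∅-minimal X refl = (S , (S∈ , S∩A≡S) , S∩B≡∅) , λ _ _ E∩B⊆∅ → Empty-unique λ (_ , x∈) → ∉⊥ (E∩B⊆∅ x∈)

  -- An edge inside S lies in a member of ℋ(A,S), so by Sperner it is that member and equals S;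
  -- then ℋ(A,S)^B = {∅}.
  no-edge⊆trace : Sperner ℋ → ∀ {A B S} → S ⊆ A → A ∩ B ≡ ∅ → ∃ (withTrace ℋ A S) →
    ¬ IsEmptySetOnly (traceMin (withTrace ℋ A S) B) → ∀ {E} → E ∈ₗ ℋ → E ⊈ S
  no-edge⊆trace sperner {A} {S = S} S⊆A A∩B≡∅ (F , F∈ , F∩A≡S) nontrivial E∈ E⊆S =
    nontrivial (edge⇒traceMin-isEmptySetOnly (subst (_∈ₗ ℋ) F≡S F∈) S⊆A A∩B≡∅)
    where
    S⊆F : S ⊆ F
    S⊆F x∈S = p∩q⊆p F A (subst (_ ∈_) (sym F∩A≡S) x∈S)

    F≡S : F ≡ S
    F≡S = ⊆-antisym (subst (_⊆ S) (Sperner⇒⊆-edge≡ sperner E∈ F∈ (⊆-trans E⊆S S⊆F)) E⊆S) S⊆F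

-- Extensions only require H ∩ Z ⊆ S so that the extra edge built from H₀ in reduced₁ is of the
-- same kind.
data ReducedEdge {n} (ℋ : Hypergraph n) (W Z S : Subset n) : Subset (suc n) → Set where
  lifted : ∀ {E} → E ∈ₗ ℋ → E ⊆ W → ReducedEdge ℋ W Z S (lift E)
  extended : ∀ {H} → H ∈ₗ ℋ → H ∩ Z ⊆ S → ReducedEdge ℋ W Z S (liftWithNew (H ─ S))

record IsReduction {n} (ℋ : Hypergraph n) (W Z S : Subset n) (R : Hypergraph (suc n)) : Set where
  field
    shape : ∀ {e} → e ∈ₗ R → ReducedEdge ℋ W Z S e
    lifted∈ : ∀ {E} → E ∈ₗ ℋ → E ⊆ W → lift E ∈ₗ R
    extended∈ : ∀ {H} → H ∈ₗ ℋ → H ∩ Z ≡ S → liftWithNew (H ─ S) ∈ₗ R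

module _ {n : ℕ} (ℋ : Hypergraph n) (W Z S : Subset n) where

  private
    lifts : Hypergraph (suc n)
    lifts = map lift (filter (_⊆? W) ℋ)

    extensions : Hypergraph (suc n)
    extensions = map (λ H → liftWithNew (H ─ S)) (filter (λ H → (H ∩ Z) ≟ₛ S) ℋ)

    ∈-lifts⁻ : ∀ {e} → e ∈ₗ lifts → ReducedEdge ℋ W Z S e
    ∈-lifts⁻ e∈ with ∈-map⁻ lift e∈
    ... | E , E∈ , refl = let E∈ℋ , E⊆W = ∈-filter⁻ (_⊆? W) {xs = ℋ} E∈ in lifted E∈ℋ E⊆W

    ∈-extensions⁻ : ∀ {e} → e ∈ₗ extensions → ReducedEdge ℋ W Z S e
    ∈-extensions⁻ e∈ with ∈-map⁻ (λ H → liftWithNew (H ─ S)) e∈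
    ... | H , H∈ , refl =
      let H∈ℋ , H∩Z≡S = ∈-filter⁻ (λ H → (H ∩ Z) ≟ₛ S) {xs = ℋ} H∈ in extended H∈ℋ (⊆-reflexive H∩Z≡S)

    ∈-lifts⁺ : ∀ {E} → E ∈ₗ ℋ → E ⊆ W → lift E ∈ₗ lifts
    ∈-lifts⁺ E∈ E⊆W = ∈-map⁺ lift (∈-filter⁺ (_⊆? W) E∈ E⊆W)

    ∈-extensions⁺ : ∀ {H} → H ∈ₗ ℋ → H ∩ Z ≡ S → liftWithNew (H ─ S) ∈ₗ extensions
    ∈-extensions⁺ H∈ H∩Z≡S =
      ∈-map⁺ (λ H → liftWithNew (H ─ S)) (∈-filter⁺ (λ H → (H ∩ Z) ≟ₛ S) H∈ H∩Z≡S)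

  reduced₁-isReduction : ∀ {H₀} → H₀ ∈ₗ ℋ → H₀ ∩ Z ⊆ S → IsReduction ℋ W Z S (reduced₁ ℋ W Z S H₀)
  reduced₁-isReduction {H₀} H₀∈ H₀∩Z⊆S = record
    { shape = shape
    ; lifted∈ = λ E∈ E⊆W → ∈-++⁺ˡ (∈-lifts⁺ E∈ E⊆W)
    ; extended∈ = λ H∈ H∩Z≡S → ∈-++⁺ʳ lifts (∈-++⁺ˡ (∈-extensions⁺ H∈ H∩Z≡S))
    }
    where
    shape : ∀ {e} → e ∈ₗ reduced₁ ℋ W Z S H₀ → ReducedEdge ℋ W Z S e
    shape e∈ with ∈-++⁻ lifts e∈
    ... | inj₁ e∈lifts = ∈-lifts⁻ e∈lifts
    ... | inj₂ e∈rest with ∈-++⁻ extensions e∈rest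
    ...   | inj₁ e∈extensions = ∈-extensions⁻ e∈extensions
    ...   | inj₂ (here refl) = extended H₀∈ H₀∩Z⊆S

  reduced₁-∋H₀ : ∀ {H₀} → liftWithNew (H₀ ─ S) ∈ₗ reduced₁ ℋ W Z S H₀
  reduced₁-∋H₀ = ∈-++⁺ʳ lifts (∈-++⁺ʳ extensions (here refl))

  -- reduced₂ ℋ V₁ V₂ S₁ keeps V₂ and contracts S₁ ⊆ V₁, hence the swapped arguments.
  reduced₂-isReduction : IsReduction ℋ W Z S (reduced₂ ℋ Z W S)
  reduced₂-isReduction = record
    { shape = λ e∈ → [ ∈-lifts⁻ , ∈-extensions⁻ ] (∈-++⁻ lifts e∈)
    ; lifted∈ = λ E∈ E⊆W → ∈-++⁺ˡ (∈-lifts⁺ E∈ E⊆W)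
    ; extended∈ = λ H∈ H∩Z≡S → ∈-++⁺ʳ lifts (∈-extensions⁺ H∈ H∩Z≡S)
    }

module Reduction {n : ℕ} (ℋ : Hypergraph n) (W Z S Sᵂ : Subset n)
  (W∩Z≡∅ : W ∩ Z ≡ ∅) (W∪Z≡⊤ : W ∪ Z ≡ full) (S⊆Z : S ⊆ Z)
  (crossing : ∀ H → H ∈ₗ ℋ → Nonempty (H ∩ W) → Nonempty (H ∩ Z) → H ∩ W ≡ Sᵂ ⊎ H ∩ Z ≡ S)
  (no-edge⊆S : ∀ {E} → E ∈ₗ ℋ → E ⊈ S)
  {R : Hypergraph (suc n)} (isReduction : IsReduction ℋ W Z S R)
  {G : Subset n} (G∈R : liftWithNew (G ─ S) ∈ₗ R) (G─S⊆Sᵂ : G ─ S ⊆ Sᵂ)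
  where

  open IsReduction isReduction

  ∈W⇒∉Z : ∀ {x} → x ∈ W → x ∉ Z
  ∈W⇒∉Z {x} x∈W x∈Z = ∉⊥ (subst (x ∈_) W∩Z≡∅ (x∈p∩q⁺ (x∈W , x∈Z)))

  ∈W⇒∉S : ∀ {x} → x ∈ W → x ∉ S
  ∈W⇒∉S x∈W = ∈W⇒∉Z x∈W ∘ S⊆Z

  ∉Z⇒∈W : ∀ {x} → x ∉ Z → x ∈ W
  ∉Z⇒∈W {x} x∉Z = [ (λ x∈W → x∈W) , (λ x∈Z → ⊥-elim (x∉Z x∈Z)) ]
    (x∈p∪q⁻ W Z (subst (x ∈_) (sym W∪Z≡⊤) ∈⊤))

  ∉W⇒∈Z : ∀ {x} → x ∉ W → x ∈ Z
  ∉W⇒∈Z {x} x∉W = decidable-stable (x ∈? Z) (x∉W ∘ ∉Z⇒∈W)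

  ∈W⇒∈─S : ∀ {x E} → x ∈ E → x ∈ W → x ∈ E ─ S
  ∈W⇒∈─S x∈E x∈W = x∈p∧x∉q⇒x∈p─q x∈E (∈W⇒∉S x∈W)

  extension⊆W : ∀ {H} → H ∩ Z ⊆ S → H ─ S ⊆ W
  extension⊆W {H} H∩Z⊆S x∈H─S = ∉Z⇒∈W λ x∈Z →
    x∈p─q⇒x∉q H S x∈H─S (H∩Z⊆S (x∈p∩q⁺ (p─q⊆p H S x∈H─S , x∈Z)))

  missedTraces : Subset n → Hypergraph n
  missedTraces T₀ = map (_∩ Z) (filter (λ E → ¬? (nonempty? (E ∩ T₀))) ℋ)

  ∈-missedTraces⁺ : ∀ {T₀ E} → E ∈ₗ ℋ → ¬ Nonempty (E ∩ T₀) → E ∩ Z ∈ₗ missedTraces T₀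
  ∈-missedTraces⁺ {T₀} E∈ misses = ∈-map⁺ (_∩ Z) (∈-filter⁺ (λ E → ¬? (nonempty? (E ∩ T₀))) E∈ misses)

  ∈-missedTraces⁻ : ∀ {T₀ F} → F ∈ₗ missedTraces T₀ →
    ∃ λ E → E ∈ₗ ℋ × ¬ Nonempty (E ∩ T₀) × F ≡ E ∩ Z
  ∈-missedTraces⁻ {T₀} F∈ with ∈-map⁻ (_∩ Z) F∈
  ... | E , E∈ , refl = let E∈ℋ , misses = ∈-filter⁻ (λ E → ¬? (nonempty? (E ∩ T₀))) {xs = ℋ} E∈ in
    E , E∈ℋ , misses , refl

  allowed : Bool → Subset n
  allowed true = Z
  allowed false = Z ─ S

  allowed⊆Z : ∀ b → allowed b ⊆ Z
  allowed⊆Z true x∈Z = x∈Z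
  allowed⊆Z false x∈Z─S = p─q⊆p Z S x∈Z─S

  collapse : Subset n → Subset (suc n)
  collapse M = does (nonempty? (M ∩ S)) ∷ (M ∩ W)

  T₀⊆W : ∀ {b T₀} → MinTransversal R (b ∷ T₀) → T₀ ⊆ W
  T₀⊆W minT x∈T₀ with minimal⇒privateEdge R minT (there x∈T₀)
  ... | e , e∈R , x∈e , _ with shape e∈R
  ...   | lifted _ E⊆W = E⊆W (drop-there x∈e)
  ...   | extended _ H∩Z⊆S = extension⊆W H∩Z⊆S (drop-there x∈e)

  missed-meets-Z : ∀ {b T₀ E} → Transversal R (b ∷ T₀) → E ∈ₗ ℋ → ¬ Nonempty (E ∩ T₀) → Nonempty (E ∩ Z)
  missed-meets-Z {b} {E = E} trT E∈ misses = decidable-stable (nonempty? (E ∩ Z)) λ E∩Z-empty →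
    misses (Nonempty-lift∩⁻ {b = b} (trT _ (lifted∈ E∈ λ x∈E → ∉Z⇒∈W (E∩Z-empty ∘ ∩-Nonempty⁺ x∈E))))

  extension-meets-T₀ : ∀ {T₀ X} → Transversal R (outside ∷ T₀) → liftWithNew X ∈ₗ R →
    ∃ λ x → x ∈ X × x ∈ T₀
  extension-meets-T₀ trT X∈R = ∩-Nonempty⁻ _ _ (Nonempty-liftWithNew∩⁻ (trT _ X∈R))

  -- Without the new vertex, T₀ hits the extension of E (if E ∩ Z = S) and that of the witness G
  -- (if E ∩ W = Sᵂ ⊇ G ∖ S); either way it would meet E.
  missed-meets-Z─S : ∀ {T₀ E} → Transversal R (outside ∷ T₀) → E ∈ₗ ℋ → ¬ Nonempty (E ∩ T₀) →
    Nonempty (E ∩ (Z ─ S))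
  missed-meets-Z─S {E = E} trT E∈ misses with nonempty? (E ∩ W)
  ... | no E∩W-empty with ⊈⇒Nonempty─ (no-edge⊆S E∈)
  ...   | x , x∈E─S =
    ∩-Nonempty⁺ x∈E (x∈p∧x∉q⇒x∈p─q (∉W⇒∈Z (E∩W-empty ∘ ∩-Nonempty⁺ x∈E)) (x∈p─q⇒x∉q E S x∈E─S))
    where
    x∈E : x ∈ E
    x∈E = p─q⊆p E S x∈E─S
  missed-meets-Z─S {E = E} trT E∈ misses | yes E∩W-nonempty =
    ⊥-elim ([ via-witness , via-extension ] (crossing E E∈ E∩W-nonempty (missed-meets-Z trT E∈ misses)))
    where
    via-witness : E ∩ W ≡ Sᵂ → ⊥
    via-witness E∩W≡Sᵂ with extension-meets-T₀ trT G∈R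
    ... | x , x∈G─S , x∈T₀ =
      misses (∩-Nonempty⁺ (p∩q⊆p E W (subst (_ ∈_) (sym E∩W≡Sᵂ) (G─S⊆Sᵂ x∈G─S))) x∈T₀)

    via-extension : E ∩ Z ≡ S → ⊥
    via-extension E∩Z≡S with extension-meets-T₀ trT (extended∈ E∈ E∩Z≡S)
    ... | x , x∈E─S , x∈T₀ = misses (∩-Nonempty⁺ (p─q⊆p E S x∈E─S) x∈T₀)

  allowed-transversal : ∀ b {T₀} → Transversal R (b ∷ T₀) → Transversal (missedTraces T₀) (allowed b)
  allowed-transversal b {T₀} trT F F∈ with ∈-missedTraces⁻ F∈
  ... | E , E∈ , misses , refl with ∩-Nonempty⁻ E (allowed b) (meets b trT)
    where
    meets : ∀ c → Transversal R (c ∷ T₀) → Nonempty (E ∩ allowed c)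
    meets true trT = missed-meets-Z trT E∈ misses
    meets false trT = missed-meets-Z─S trT E∈ misses
  ...   | x , x∈E , x∈A = ∩-Nonempty⁺ (x∈p∩q⁺ (x∈E , allowed⊆Z b x∈A)) x∈A

  union-transversal : ∀ {T₀ K} → Transversal (missedTraces T₀) K → Transversal ℋ (T₀ ∪ K)
  union-transversal {T₀} {K} trK E E∈ with nonempty? (E ∩ T₀)
  ... | yes E∩T₀-nonempty with ∩-Nonempty⁻ E T₀ E∩T₀-nonempty
  ...   | x , x∈E , x∈T₀ = ∩-Nonempty⁺ x∈E (x∈p∪q⁺ (inj₁ x∈T₀))
  union-transversal {T₀} {K} trK E E∈ | no misses
    with ∩-Nonempty⁻ (E ∩ Z) K (trK _ (∈-missedTraces⁺ E∈ misses))
  ... | x , x∈E∩Z , x∈K = ∩-Nonempty⁺ (p∩q⊆p E Z x∈E∩Z) (x∈p∪q⁺ (inj₂ x∈K))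

  lifted-private : ∀ {b T₀ K E x} → K ⊆ Z → E ⊆ W →
    MeetsOnlyAt (lift E) (b ∷ T₀) (suc x) → MeetsOnlyAt E (T₀ ∪ K) x
  lifted-private {T₀ = T₀} {K} K⊆Z E⊆W only {y} y∈E y∈T₀∪K =
    [ (λ y∈T₀ → suc-injective (only (there y∈E) (there y∈T₀)))
    , (λ y∈K → ⊥-elim (∈W⇒∉Z (E⊆W y∈E) (K⊆Z y∈K))) ]
    (x∈p∪q⁻ T₀ K y∈T₀∪K)

  extended-private : ∀ b {T₀ K H x} → T₀ ⊆ W → K ⊆ allowed b → H ∩ Z ⊆ S →
    MeetsOnlyAt (liftWithNew (H ─ S)) (b ∷ T₀) (suc x) → MeetsOnlyAt H (T₀ ∪ K) x
  extended-private true _ _ _ only _ _ = ⊥-elim (0≢1+n (only here here))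
  extended-private false {T₀} {K} T₀⊆W K⊆Z─S H∩Z⊆S only y∈H y∈T₀∪K =
    [ (λ y∈T₀ → suc-injective (only (there (∈W⇒∈─S y∈H (T₀⊆W y∈T₀))) (there y∈T₀)))
    , (λ y∈K → let y∈Z , y∉S = p─q⊆p Z S (K⊆Z─S y∈K) , x∈p─q⇒x∉q Z S (K⊆Z─S y∈K) in
         ⊥-elim (y∉S (H∩Z⊆S (x∈p∩q⁺ (y∈H , y∈Z))))) ]
    (x∈p∪q⁻ T₀ K y∈T₀∪K)

  private-T₀ : ∀ b {T₀ K} → MinTransversal R (b ∷ T₀) → K ⊆ allowed b →
    ∀ {x} → x ∈ T₀ → ∃ λ E → E ∈ₗ ℋ × MeetsOnlyAt E (T₀ ∪ K) x
  private-T₀ b minT K⊆A x∈T₀ with minimal⇒privateEdge R minT (there x∈T₀)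
  ... | e , e∈R , _ , only with shape e∈R
  ...   | lifted E∈ E⊆W = _ , E∈ , lifted-private (allowed⊆Z b ∘ K⊆A) E⊆W only
  ...   | extended H∈ H∩Z⊆S = _ , H∈ , extended-private b (T₀⊆W minT) K⊆A H∩Z⊆S only

  private-K : ∀ {T₀ K} → K ⊆ Z → MinTransversal (missedTraces T₀) K →
    ∀ {x} → x ∈ K → ∃ λ E → E ∈ₗ ℋ × MeetsOnlyAt E (T₀ ∪ K) x
  private-K {T₀} {K} K⊆Z minK x∈K with minimal⇒privateEdge (missedTraces T₀) minK x∈K
  ... | F , F∈ , _ , only with ∈-missedTraces⁻ F∈
  ...   | E , E∈ , misses , refl = E , E∈ , λ y∈E y∈T₀∪K →
    [ (λ y∈T₀ → ⊥-elim (misses (∩-Nonempty⁺ y∈E y∈T₀))) , (λ y∈K → only (x∈p∩q⁺ (y∈E , K⊆Z y∈K)) y∈K) ]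
    (x∈p∪q⁻ T₀ K y∈T₀∪K)

  union-minimal : ∀ b {T₀ K} → MinTransversal R (b ∷ T₀) → K ⊆ allowed b →
    MinTransversal (missedTraces T₀) K → MinTransversal ℋ (T₀ ∪ K)
  union-minimal b {T₀} {K} minT K⊆A minK = privateEdges⇒minimal ℋ (union-transversal (proj₁ minK))
    λ x∈T₀∪K → [ private-T₀ b minT K⊆A , private-K (allowed⊆Z b ∘ K⊆A) minK ] (x∈p∪q⁻ T₀ K x∈T₀∪K)

  union∩W : ∀ {T₀ K} → T₀ ⊆ W → K ⊆ Z → (T₀ ∪ K) ∩ W ≡ T₀
  union∩W {T₀} {K} T₀⊆W K⊆Z = ⊆-antisym
    (λ x∈ → let x∈T₀∪K , x∈W = x∈p∩q⁻ (T₀ ∪ K) W x∈ in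
      [ (λ x∈T₀ → x∈T₀) , (λ x∈K → ⊥-elim (∈W⇒∉Z x∈W (K⊆Z x∈K))) ] (x∈p∪q⁻ T₀ K x∈T₀∪K))
    (λ x∈T₀ → x∈p∩q⁺ (x∈p∪q⁺ (inj₁ x∈T₀) , T₀⊆W x∈T₀))

  -- With the new vertex in T, its private edge is the extension of some H ∈ ℋ missed by T₀,
  -- and K meets H ∩ Z ⊆ S.
  union-meets-S : ∀ b {T₀ K} → MinTransversal R (b ∷ T₀) → K ⊆ allowed b →
    Transversal (missedTraces T₀) K → does (nonempty? ((T₀ ∪ K) ∩ S)) ≡ b
  union-meets-S false {T₀} {K} minT K⊆Z─S _ = dec-false (nonempty? _) λ T₀∪K∩S-nonempty →
    let x , x∈T₀∪K , x∈S = ∩-Nonempty⁻ (T₀ ∪ K) S T₀∪K∩S-nonempty in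
    [ (λ x∈T₀ → ∈W⇒∉S (T₀⊆W minT x∈T₀) x∈S) , (λ x∈K → x∈p─q⇒x∉q Z S (K⊆Z─S x∈K) x∈S) ]
    (x∈p∪q⁻ T₀ K x∈T₀∪K)
  union-meets-S true {T₀} {K} minT _ trK with minimal⇒privateEdge R minT here
  ... | e , e∈R , new∈e , only with shape e∈R
  ...   | lifted _ _ with new∈e
  ...     | ()
  union-meets-S true {T₀} {K} minT _ trK | e , e∈R , new∈e , only | extended {H} H∈ H∩Z⊆S
    with ∩-Nonempty⁻ (H ∩ Z) K (trK _ (∈-missedTraces⁺ H∈ misses))
    where
    misses : ¬ Nonempty (H ∩ T₀)
    misses (y , y∈H∩T₀) = let y∈H , y∈T₀ = x∈p∩q⁻ H T₀ y∈H∩T₀ in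
      0≢1+n (sym (only (there (∈W⇒∈─S y∈H (T₀⊆W minT y∈T₀))) (there y∈T₀)))
  ... | y , y∈H∩Z , y∈K = dec-true (nonempty? _) (∩-Nonempty⁺ (x∈p∪q⁺ (inj₂ y∈K)) (H∩Z⊆S y∈H∩Z))

  collapse-onto : ∀ T → MinTransversal R T → ∃ λ M → MinTransversal ℋ M × collapse M ≡ T
  collapse-onto (b ∷ T₀) minT with minimal-⊆ (missedTraces T₀) (allowed-transversal b (proj₁ minT))
  ... | K , K⊆A , minK =
    T₀ ∪ K , union-minimal b minT K⊆A minK ,
    cong₂ _∷_ (union-meets-S b minT K⊆A (proj₁ minK)) (union∩W (T₀⊆W minT) (allowed⊆Z b ∘ K⊆A))

  ∣Tr∣≤ : ∣Tr R ∣ ≤ ∣Tr ℋ ∣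
  ∣Tr∣≤ = countSubsets-≤ (minTransversal? R) (minTransversal? ℋ) collapse collapse-onto

lemma2 : ∀ {n} (ℋ : Hypergraph n) (V₁ V₂ S₁ S₂ : Subset n) →
  Unimodular ℋ → Sperner ℋ →
  V₁ ∩ V₂ ≡ ∅ → V₁ ∪ V₂ ≡ full → Nonempty V₁ → Nonempty V₂ →
  S₁ ⊆ V₁ → S₂ ⊆ V₂ → Nonempty S₁ → Nonempty S₂ →
  (∀ H → H ∈ₗ ℋ → Nonempty (H ∩ V₁) → Nonempty (H ∩ V₂) →
    H ∩ V₁ ≡ S₁ ⊎ H ∩ V₂ ≡ S₂) →
  ∃ (withTrace ℋ V₁ S₁) →
  ¬ IsEmptySetOnly (traceMin (withTrace ℋ V₁ S₁) V₂) →
  ∃ (withTrace ℋ V₂ S₂) →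
  ¬ IsEmptySetOnly (traceMin (withTrace ℋ V₂ S₂) V₁) →
  ∣ V₁ ∣ + countSubsets (restrict∪withTrace? ℋ V₁ V₂ S₂) ≥ 4 →
  ∣ V₂ ∣ + countSubsets (restrict∪withTrace? ℋ V₂ V₁ S₁) ≥ 4 →
  (H₀ : Subset n) → H₀ ∈ₗ ℋ → H₀ ⊆ S₁ ∪ S₂ → H₀ ∩ V₁ ≡ S₁ → H₀ ∩ V₂ ⊆ S₂ →
  ∣Tr reduced₁ ℋ V₁ V₂ S₂ H₀ ∣ ≤ ∣Tr ℋ ∣ × ∣Tr reduced₂ ℋ V₁ V₂ S₁ ∣ ≤ ∣Tr ℋ ∣
lemma2 ℋ V₁ V₂ S₁ S₂ _ sperner V₁∩V₂≡∅ V₁∪V₂≡⊤ _ _ S₁⊆V₁ S₂⊆V₂ _ _ crossing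
  ℋ[V₁,S₁]≢∅ nontrivial₁ ℋ[V₂,S₂]≢∅ nontrivial₂ _ _ H₀ H₀∈ H₀⊆S₁∪S₂ H₀∩V₁≡S₁ H₀∩V₂⊆S₂ =
  Reduced₁.∣Tr∣≤ , Reduced₂.∣Tr∣≤
  where
  V₂∩V₁≡∅ : V₂ ∩ V₁ ≡ ∅
  V₂∩V₁≡∅ = trans (∩-comm V₂ V₁) V₁∩V₂≡∅

  module Reduced₁ = Reduction ℋ V₁ V₂ S₂ S₁ V₁∩V₂≡∅ V₁∪V₂≡⊤ S₂⊆V₂ crossing
    (no-edge⊆trace sperner S₂⊆V₂ V₂∩V₁≡∅ ℋ[V₂,S₂]≢∅ nontrivial₂)
    (reduced₁-isReduction ℋ V₁ V₂ S₂ H₀∈ H₀∩V₂⊆S₂)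
    (reduced₁-∋H₀ ℋ V₁ V₂ S₂) (⊆∪⇒─⊆ (⊆-trans H₀⊆S₁∪S₂ (⊆-reflexive (∪-comm S₁ S₂))))

  module Reduced₂ = Reduction ℋ V₂ V₁ S₁ S₂ V₂∩V₁≡∅ (trans (∪-comm V₂ V₁) V₁∪V₂≡⊤) S₁⊆V₁
    (λ H H∈ meets₂ meets₁ → swap (crossing H H∈ meets₁ meets₂))
    (no-edge⊆trace sperner S₁⊆V₁ V₁∩V₂≡∅ ℋ[V₁,S₁]≢∅ nontrivial₁)
    (reduced₂-isReduction ℋ V₂ V₁ S₁)
    (IsReduction.extended∈ (reduced₂-isReduction ℋ V₂ V₁ S₁) H₀∈ H₀∩V₁≡S₁) (⊆∪⇒─⊆ H₀⊆S₁∪S₂)
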